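{- Let $k\ge 2$ and let the starting configuration be $S=\{a,b,c,x_1,\dots,x_m\}$ with $a\le b\le c$. Suppose that either there is an optimal $k$-step strategy in which Alice plays $(b,c)$ in the first step and $(a,b+c)$ in the second step, or there is an optimal $k$-step strategy in which Alice plays $(a,c)$ in the first step and $(b,a+c)$ in the second step. Then there exists an optimal $k$-step strategy in which Alice plays $(a,b)$ in the first step and $(c,a+b)$ in the second step.
   Context: One-player game: Alice has $n\ge2$ sheets of paper, each with a positive integer written on it. A move consists of choosing two sheets, with numbers $a$ and $b$, erasing them and writing $a+b$ on both sheets; this move is denoted $(a,b)$. The configuration is the multiset of the numbers on the sheets. $opt(S,k)$ is the smallest possible sum of the numbers after exactly $k$ moves starting from configuration $S$. An optimal $k$-step strategy is a sequence of $k$ moves from the starting configuration after which the sum of the numbers equals $opt(S,k)$. -}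

module Defs where

open import Data.Nat using (ℕ; _+_; _≤_)
open import Data.Fin using (Fin)
open import Data.Vec using (Vec; lookup; _[_]≔_; toList)
open import Data.List using (List; []; _∷_; length)
open import Data.Nat.ListAction using (sum)
open import Data.Product using (Σ; _×_; ∃; ∃-syntax; _,_)
open import Data.Sum using (_⊎_)
open import Relation.Binary.PropositionalEquality using (_≡_; _≢_)

-- A configuration of n sheets: the number written on each sheet.
Config : ℕ → Set
Config n = Vec ℕ n

record Move (n : ℕ) : Set where
  constructor mv
  field
    i : Fin n
    j : Fin n
    i≢j : i ≢ j
open Move public

apply : ∀ {n} → Config n → Move n → Config n
apply C (mv i j _) = let s = lookup C i + lookup C j in (C [ i ]≔ s) [ j ]≔ s

run : ∀ {n} → Config n → List (Move n) → Config n
run C [] = C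
run C (μ ∷ ms) = run (apply C μ) ms

total : ∀ {n} → Config n → ℕ
total C = sum (toList C)

Optimal : ∀ {n} → Config n → ℕ → List (Move n) → Set
Optimal S k ms = length ms ≡ k × (∀ (ms' : List (Move _)) → length ms' ≡ k → total (run S ms) ≤ total (run S ms'))

Plays : ∀ {n} → ℕ → ℕ → Config n → Move n → Set
Plays u v C μ = (lookup C (i μ) ≡ u × lookup C (j μ) ≡ v) ⊎ (lookup C (i μ) ≡ v × lookup C (j μ) ≡ u)

FirstTwo : ∀ {n} → Config n → ℕ → ℕ → ℕ → ℕ → List (Move n) → Set
FirstTwo S u v u' v' ms =
  ∃[ μ₁ ] ∃[ μ₂ ] ∃[ rest ] (ms ≡ μ₁ ∷ μ₂ ∷ rest × Plays u v S μ₁ × Plays u' v' (apply S μ₁) μ₂)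

-- Suppose an optimal strategy first merges sheets P, Q (values p, c) and then merges a
-- sheet R of value r ≤ c with a sheet X now carrying p + c.  Playing (r, p) and then
-- (c, r + p) instead ends with the values r + p + c on Q and R and r + p ≤ p + c on P,
-- which is sheet-wise below the original position once Q and X are exchanged.  Since
-- merging is monotone, replaying the remaining moves (with Q and X exchanged) keeps every
-- sheet below, so the total does not increase and the new strategy is optimal as well.
module Submission where

open import Defs
open import Data.Nat using (ℕ; zero; suc; _+_; _≤_; _<_; z≤n)
open import Data.Nat.Properties
  using (+-comm; +-assoc; +-mono-≤; +-monoʳ-≤; ≤-reflexive; ≤-trans; <-irrefl;
         ≤-<-trans; m≤m+n; m≤n+m; m<m+n; m<n+m; +-0-commutativeMonoid; module ≤-Reasoning)
open import Data.Fin using (Fin; _≟_) renaming (zero to fzero; suc to fsuc)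
open import Data.Fin.Permutation using (Permutation; _⟨$⟩ʳ_; _⟨$⟩ˡ_; inverseʳ; inverseˡ; transpose)
open import Data.Vec using (Vec; []; _∷_; lookup; _[_]≔_)
open import Data.Vec.Properties using (lookup∘update; lookup∘update′; []≔-commutes)
open import Data.Vec.Relation.Unary.All using (All; _∷_)
open import Data.List using (List; []; _∷_; length; map)
open import Data.List.Properties using (length-map)
open import Data.Product using (Σ; ∃₂; _×_; _,_; proj₁; proj₂; map₂; ∃-syntax)
open import Data.Sum using (_⊎_; inj₁; inj₂; swap)
open import Data.Empty using (⊥)
open import Function using (_∘_)
open import Relation.Nullary using (Dec; yes; no)
open import Relation.Binary.PropositionalEquality
  using (_≡_; _≢_; refl; sym; trans; cong; cong₂; subst; subst₂)
import Algebra.Properties.CommutativeMonoid.Sum +-0-commutativeMonoid as ∑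

private variable
  n : ℕ
  C D : Config n

lookup-apply-i : (C : Config n) {i j : Fin n} (i≢j : i ≢ j) →
                 lookup (apply C (mv i j i≢j)) i ≡ lookup C i + lookup C j
lookup-apply-i C {i} {j} i≢j = trans (lookup∘update′ i≢j (C [ i ]≔ _) _) (lookup∘update i C _)

lookup-apply-j : (C : Config n) {i j : Fin n} (i≢j : i ≢ j) →
                 lookup (apply C (mv i j i≢j)) j ≡ lookup C i + lookup C j
lookup-apply-j C {i} {j} i≢j = lookup∘update j (C [ i ]≔ _) _

lookup-apply-other : (C : Config n) {i j x : Fin n} (i≢j : i ≢ j) → x ≢ i → x ≢ j →
                     lookup (apply C (mv i j i≢j)) x ≡ lookup C x
lookup-apply-other C {i} i≢j x≢i x≢j =
  trans (lookup∘update′ x≢j (C [ i ]≔ _) _) (lookup∘update′ x≢i C _)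

lookup-≤-apply : (C : Config n) (μ : Move n) (x : Fin n) → lookup C x ≤ lookup (apply C μ) x
lookup-≤-apply C (mv i j i≢j) x with x ≟ i | x ≟ j
... | _        | yes refl = subst (lookup C x ≤_) (sym (lookup-apply-j C i≢j)) (m≤n+m _ _)
... | yes refl | no _     = subst (lookup C x ≤_) (sym (lookup-apply-i C i≢j)) (m≤m+n _ _)
... | no x≢i   | no x≢j   = ≤-reflexive (sym (lookup-apply-other C i≢j x≢i x≢j))

apply-sym : (C : Config n) {i j : Fin n} (i≢j : i ≢ j) →
            apply C (mv i j i≢j) ≡ apply C (mv j i (i≢j ∘ sym))
apply-sym C {i} {j} i≢j =
  trans ([]≔-commutes C i j i≢j)
        (cong (λ s → (C [ j ]≔ s) [ i ]≔ s) (+-comm (lookup C i) (lookup C j)))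

Plays⇒oriented : (C : Config n) (μ : Move n) {u v : ℕ} → Plays u v C μ →
                 ∃₂ λ P Q → Σ (P ≢ Q) λ P≢Q →
                   lookup C P ≡ u × lookup C Q ≡ v × apply C μ ≡ apply C (mv P Q P≢Q)
Plays⇒oriented C (mv i j i≢j) (inj₁ (Ci≡u , Cj≡v)) = i , j , i≢j , Ci≡u , Cj≡v , refl
Plays⇒oriented C (mv i j i≢j) (inj₂ (Ci≡v , Cj≡u)) =
  j , i , i≢j ∘ sym , Cj≡u , Ci≡v , apply-sym C i≢j

_≤[_]_ : Config n → Permutation n n → Config n → Set
C ≤[ π ] D = ∀ x → lookup C x ≤ lookup D (π ⟨$⟩ʳ x)

relabel : Permutation n n → Move n → Move n
relabel π (mv i j i≢j) = mv (π ⟨$⟩ˡ i) (π ⟨$⟩ˡ j) (i≢j ∘ πˡ-injective)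
  where
  πˡ-injective : ∀ {x y} → π ⟨$⟩ˡ x ≡ π ⟨$⟩ˡ y → x ≡ y
  πˡ-injective {x} {y} e = trans (sym (inverseʳ π)) (trans (cong (π ⟨$⟩ʳ_) e) (inverseʳ π))

apply-mono : (π : Permutation n n) (μ : Move n) → C ≤[ π ] D →
             apply C (relabel π μ) ≤[ π ] apply D μ
apply-mono {C = C} {D = D} π μ@(mv i j i≢j) C≤D x = by-cases (x ≟ π ⟨$⟩ˡ i) (x ≟ π ⟨$⟩ˡ j)
  where
  open ≤-Reasoning
  ν = relabel π μ
  at : ∀ y → lookup C (π ⟨$⟩ˡ y) ≤ lookup D y
  at y = subst (λ z → lookup C (π ⟨$⟩ˡ y) ≤ lookup D z) (inverseʳ π) (C≤D (π ⟨$⟩ˡ y))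
  merged-≤ : ∀ {y c} → c ≡ lookup C (π ⟨$⟩ˡ i) + lookup C (π ⟨$⟩ˡ j) →
             lookup (apply D μ) y ≡ lookup D i + lookup D j →
             c ≤ lookup (apply D μ) (π ⟨$⟩ʳ (π ⟨$⟩ˡ y))
  merged-≤ refl Dy≡ =
    subst (_ ≤_) (trans (sym Dy≡) (cong (lookup (apply D μ)) (sym (inverseʳ π))))
          (+-mono-≤ (at i) (at j))
  ⟨$⟩ˡ-from : ∀ {y} → π ⟨$⟩ʳ x ≡ y → x ≡ π ⟨$⟩ˡ y
  ⟨$⟩ˡ-from refl = sym (inverseˡ π)
  by-cases : Dec (x ≡ π ⟨$⟩ˡ i) → Dec (x ≡ π ⟨$⟩ˡ j) →
             lookup (apply C ν) x ≤ lookup (apply D μ) (π ⟨$⟩ʳ x)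
  by-cases _          (yes refl) = merged-≤ (lookup-apply-j C (Move.i≢j ν)) (lookup-apply-j D i≢j)
  by-cases (yes refl) (no _)     = merged-≤ (lookup-apply-i C (Move.i≢j ν)) (lookup-apply-i D i≢j)
  by-cases (no x≢i)   (no x≢j)   = begin
    lookup (apply C ν) x              ≡⟨ lookup-apply-other C (Move.i≢j ν) x≢i x≢j ⟩
    lookup C x                        ≤⟨ C≤D x ⟩
    lookup D (π ⟨$⟩ʳ x)
      ≡⟨ lookup-apply-other D i≢j (x≢i ∘ ⟨$⟩ˡ-from) (x≢j ∘ ⟨$⟩ˡ-from) ⟨
    lookup (apply D μ) (π ⟨$⟩ʳ x)     ∎

run-mono : (π : Permutation n n) (ms : List (Move n)) → C ≤[ π ] D →
           run C (map (relabel π) ms) ≤[ π ] run D ms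
run-mono π []       C≤D = C≤D
run-mono {C = C} {D = D} π (μ ∷ ms) C≤D =
  run-mono π ms (apply-mono {C = C} {D = D} π μ C≤D)

total≡∑lookup : (C : Config n) → total C ≡ ∑.sum (lookup C)
total≡∑lookup []      = refl
total≡∑lookup (x ∷ C) = cong (x +_) (total≡∑lookup C)

∑-mono-≤ : (f g : Fin n → ℕ) → (∀ x → f x ≤ g x) → ∑.sum f ≤ ∑.sum g
∑-mono-≤ {zero}  f g f≤g = z≤n
∑-mono-≤ {suc n} f g f≤g = +-mono-≤ (f≤g fzero) (∑-mono-≤ (f ∘ fsuc) (g ∘ fsuc) (f≤g ∘ fsuc))

total-mono : (π : Permutation n n) → C ≤[ π ] D → total C ≤ total D
total-mono {C = C} {D = D} π C≤D = begin
  total C                              ≡⟨ total≡∑lookup C ⟩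
  ∑.sum (lookup C)                     ≤⟨ ∑-mono-≤ _ _ C≤D ⟩
  ∑.sum (λ x → lookup D (π ⟨$⟩ʳ x))    ≡⟨ ∑.sum-permute (lookup D) π ⟨
  ∑.sum (lookup D)                     ≡⟨ total≡∑lookup D ⟨
  total D                              ∎
  where open ≤-Reasoning

exchange-≤ : (S : Config n) {P Q R X : Fin n}
  (P≢Q : P ≢ Q) (R≢P : R ≢ P) (Q≢R : Q ≢ R) (R≢X : R ≢ X) →
  lookup S R ≤ lookup S Q →
  lookup (apply S (mv P Q P≢Q)) X ≡ lookup S P + lookup S Q →
  apply (apply S (mv R P R≢P)) (mv Q R Q≢R)
    ≤[ transpose Q X ] apply (apply S (mv P Q P≢Q)) (mv R X R≢X)
exchange-≤ S {P} {Q} {R} {X} P≢Q R≢P Q≢R R≢X r≤c V₁X≡p+c = below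
  where
  p = lookup S P
  c = lookup S Q
  r = lookup S R
  W₁ = apply S (mv R P R≢P)
  W = apply W₁ (mv Q R Q≢R)
  V₁ = apply S (mv P Q P≢Q)
  V = apply V₁ (mv R X R≢X)

  W₁Q≡c : lookup W₁ Q ≡ c
  W₁Q≡c = lookup-apply-other S R≢P Q≢R (P≢Q ∘ sym)
  W-merged : lookup W Q ≡ c + (r + p) × lookup W R ≡ c + (r + p)
  W-merged = trans (lookup-apply-i W₁ Q≢R) (cong₂ _+_ W₁Q≡c (lookup-apply-i S R≢P))
           , trans (lookup-apply-j W₁ Q≢R) (cong₂ _+_ W₁Q≡c (lookup-apply-i S R≢P))

  V₁R≡r : lookup V₁ R ≡ r
  V₁R≡r = lookup-apply-other S P≢Q R≢P (Q≢R ∘ sym)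
  V-merged : lookup V R ≡ r + (p + c) × lookup V X ≡ r + (p + c)
  V-merged = trans (lookup-apply-i V₁ R≢X) (cong₂ _+_ V₁R≡r V₁X≡p+c)
           , trans (lookup-apply-j V₁ R≢X) (cong₂ _+_ V₁R≡r V₁X≡p+c)

  c+[r+p]≡r+[p+c] : c + (r + p) ≡ r + (p + c)
  c+[r+p]≡r+[p+c] = trans (+-comm c (r + p)) (+-assoc r p c)

  W≤V₁ : ∀ x → x ≢ Q → x ≢ R → lookup W x ≤ lookup V₁ x
  W≤V₁ x x≢Q x≢R with x ≟ P
  ... | yes refl = begin
    lookup W P   ≡⟨ trans (lookup-apply-other W₁ Q≢R x≢Q x≢R) (lookup-apply-j S R≢P) ⟩
    r + p        ≤⟨ ≤-reflexive (+-comm r p) ⟩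
    p + r        ≤⟨ +-monoʳ-≤ p r≤c ⟩
    p + c        ≡⟨ lookup-apply-i S P≢Q ⟨
    lookup V₁ P  ∎
    where open ≤-Reasoning
  ... | no x≢P = ≤-reflexive (begin-equality
    lookup W x   ≡⟨ lookup-apply-other W₁ Q≢R x≢Q x≢R ⟩
    lookup W₁ x  ≡⟨ lookup-apply-other S R≢P x≢R x≢P ⟩
    lookup S x   ≡⟨ lookup-apply-other S P≢Q x≢P x≢Q ⟨
    lookup V₁ x  ∎)
    where open ≤-Reasoning

  -- Splitting on x ≟ Q and then x ≟ X, as the definition of transpose does,
  -- reduces transpose Q X ⟨$⟩ʳ x in every branch.
  below : W ≤[ transpose Q X ] V
  below x with x ≟ Q
  ... | yes refl = ≤-reflexive (begin-equality
    lookup W x     ≡⟨ proj₁ W-merged ⟩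
    c + (r + p)    ≡⟨ c+[r+p]≡r+[p+c] ⟩
    r + (p + c)    ≡⟨ proj₂ V-merged ⟨
    lookup V X     ∎)
    where open ≤-Reasoning
  ... | no x≢Q with x ≟ X
  ...   | yes refl = begin
    lookup W x   ≤⟨ W≤V₁ x x≢Q (R≢X ∘ sym) ⟩
    lookup V₁ x  ≡⟨ trans V₁X≡p+c (sym (lookup-apply-j S P≢Q)) ⟩
    lookup V₁ Q  ≤⟨ lookup-≤-apply V₁ (mv R x R≢X) Q ⟩
    lookup V Q   ∎
    where open ≤-Reasoning
  ...   | no x≢X with x ≟ R
  ...     | yes refl = ≤-reflexive (begin-equality
    lookup W x     ≡⟨ proj₂ W-merged ⟩
    c + (r + p)    ≡⟨ c+[r+p]≡r+[p+c] ⟩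
    r + (p + c)    ≡⟨ proj₁ V-merged ⟨
    lookup V x     ∎)
    where open ≤-Reasoning
  ...     | no x≢R = ≤-trans (W≤V₁ x x≢Q x≢R) (lookup-≤-apply V₁ (mv R X R≢X) x)

Optimal-if-≤ : (S : Config n) {k : ℕ} (ms ms′ : List (Move n)) → Optimal S k ms →
               length ms′ ≡ k → total (run S ms′) ≤ total (run S ms) → Optimal S k ms′
Optimal-if-≤ S ms ms′ (_ , ms-min) len′ ms′≤ms =
  len′ , λ ms″ len″ → ≤-trans ms′≤ms (ms-min ms″ len″)

FirstTwo-swap : (S : Config n) {u v w : ℕ} (ms : List (Move n)) →
                FirstTwo S u v w (u + v) ms → FirstTwo S v u w (v + u) ms
FirstTwo-swap S {u} {v} {w} ms (μ₁ , μ₂ , rest , ms≡ , plays₁ , plays₂) =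
  μ₁ , μ₂ , rest , ms≡ , swap plays₁ ,
  subst (λ s → Plays w s (apply S μ₁) μ₂) (+-comm u v) plays₂

exchange-Optimal : (S : Config n) {k p c r : ℕ} (μ₁ μ₂ : Move n) (rest : List (Move n)) →
  Optimal S k (μ₁ ∷ μ₂ ∷ rest) → Plays p c S μ₁ → Plays r (p + c) (apply S μ₁) μ₂ →
  r < p + c → r ≤ c → ∃[ ms ] (Optimal S k ms × FirstTwo S r p c (r + p) ms)
exchange-Optimal S {p = p} {c} {r} μ₁ μ₂ rest optimal plays₁ plays₂ r<p+c r≤c
  with Plays⇒oriented S μ₁ plays₁
... | P , Q , P≢Q , SP≡p , SQ≡c , V₁≡ with Plays⇒oriented (apply S μ₁) μ₂ plays₂
... | R , X , R≢X , V₁R≡r , V₁X≡p+c , V≡ =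
  ν₁ ∷ ν₂ ∷ rest′ ,
  Optimal-if-≤ S (μ₁ ∷ μ₂ ∷ rest) (ν₁ ∷ ν₂ ∷ rest′) optimal
    (trans (cong (suc ∘ suc) (length-map (relabel π) rest)) (proj₁ optimal)) new≤old ,
  ν₁ , ν₂ , rest′ , refl , inj₁ (SR≡r , SP≡p) , inj₁ (W₁Q≡c , W₁R≡r+p)
  where
  V₁ = apply S (mv P Q P≢Q)
  V = apply V₁ (mv R X R≢X)
  lookup-V₁ : ∀ {y v} → lookup (apply S μ₁) y ≡ v → lookup V₁ y ≡ v
  lookup-V₁ {y} = trans (cong (λ C → lookup C y) (sym V₁≡))
  V₁-merged : ∀ {y} → y ≡ P ⊎ y ≡ Q → lookup V₁ y ≡ p + c
  V₁-merged (inj₁ refl) = trans (lookup-apply-i S P≢Q) (cong₂ _+_ SP≡p SQ≡c)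
  V₁-merged (inj₂ refl) = trans (lookup-apply-j S P≢Q) (cong₂ _+_ SP≡p SQ≡c)
  R-unmerged : ∀ {y} → R ≡ y → y ≡ P ⊎ y ≡ Q → ⊥
  R-unmerged refl R∈PQ = <-irrefl (trans (sym (lookup-V₁ V₁R≡r)) (V₁-merged R∈PQ)) r<p+c
  R≢P : R ≢ P
  R≢P R≡P = R-unmerged R≡P (inj₁ refl)
  Q≢R : Q ≢ R
  Q≢R Q≡R = R-unmerged (sym Q≡R) (inj₂ refl)
  SR≡r : lookup S R ≡ r
  SR≡r = trans (sym (lookup-apply-other S P≢Q R≢P (Q≢R ∘ sym))) (lookup-V₁ V₁R≡r)
  ν₁ = mv R P R≢P
  ν₂ = mv Q R Q≢R
  W₁ = apply S ν₁
  W = apply W₁ ν₂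
  W₁Q≡c : lookup W₁ Q ≡ c
  W₁Q≡c = trans (lookup-apply-other S R≢P Q≢R (P≢Q ∘ sym)) SQ≡c
  W₁R≡r+p : lookup W₁ R ≡ r + p
  W₁R≡r+p = trans (lookup-apply-i S R≢P) (cong₂ _+_ SR≡r SP≡p)
  π = transpose Q X
  rest′ = map (relabel π) rest
  W≤V : W ≤[ π ] V
  W≤V = exchange-≤ S P≢Q R≢P Q≢R R≢X
          (subst₂ _≤_ (sym SR≡r) (sym SQ≡c) r≤c)
          (trans (lookup-V₁ V₁X≡p+c) (sym (cong₂ _+_ SP≡p SQ≡c)))
  old-position : apply (apply S μ₁) μ₂ ≡ V
  old-position = trans V≡ (cong (λ C → apply C (mv R X R≢X)) V₁≡)
  new≤old : total (run S (ν₁ ∷ ν₂ ∷ rest′)) ≤ total (run S (μ₁ ∷ μ₂ ∷ rest))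
  new≤old = subst (total (run S (ν₁ ∷ ν₂ ∷ rest′)) ≤_)
              (cong (λ C → total (run C rest)) (sym old-position))
              (total-mono {C = run W rest′} {D = run V rest} π (run-mono π rest W≤V))

lemma5 : (k m : ℕ) (a b c : ℕ) (xs : Vec ℕ m) →
    2 ≤ k →
    All (0 <_) (a ∷ b ∷ c ∷ xs) →
    a ≤ b → b ≤ c →
    ((∃[ ms ] (Optimal (a ∷ b ∷ c ∷ xs) k ms × FirstTwo (a ∷ b ∷ c ∷ xs) b c a (b + c) ms))
      ⊎ (∃[ ms ] (Optimal (a ∷ b ∷ c ∷ xs) k ms × FirstTwo (a ∷ b ∷ c ∷ xs) a c b (a + c) ms))) →
    ∃[ ms ] (Optimal (a ∷ b ∷ c ∷ xs) k ms × FirstTwo (a ∷ b ∷ c ∷ xs) a b c (a + b) ms)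
-- The hypothesis 2 ≤ k is implied by the given strategy having two first moves.
lemma5 k m a b c xs _ (0<a ∷ _ ∷ 0<c ∷ _) a≤b b≤c
  (inj₁ (_ , optimal , μ₁ , μ₂ , rest , refl , plays₁ , plays₂)) =
  exchange-Optimal (a ∷ b ∷ c ∷ xs) μ₁ μ₂ rest optimal plays₁ plays₂
    (≤-<-trans a≤b (m<m+n b 0<c)) (≤-trans a≤b b≤c)
lemma5 k m a b c xs _ (0<a ∷ _ ∷ 0<c ∷ _) a≤b b≤c
  (inj₂ (_ , optimal , μ₁ , μ₂ , rest , refl , plays₁ , plays₂)) =
  map₂ (map₂ (FirstTwo-swap (a ∷ b ∷ c ∷ xs) _))
    (exchange-Optimal (a ∷ b ∷ c ∷ xs) μ₁ μ₂ rest optimal plays₁ plays₂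
      (≤-<-trans b≤c (m<n+m c 0<a)) b≤c)
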